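{- Let $\mathcal A$ be a commutative unital $\mathbb Q$-algebra, let $\zeta:N\to\mathcal A$ be a linear map (a "partially defined character"), and let $X_{\mathcal A,\zeta}:=\{\alpha\in G_{\mathcal A}:\alpha|_N=\zeta\}$. Then the map $T_{\mathcal A}\times X_{\mathcal A,\zeta}\to X_{\mathcal A,\zeta}$, $(\phi,\alpha)\mapsto\phi\star\alpha$, is a well-defined left group action of $T_{\mathcal A}$ on $X_{\mathcal A,\zeta}$, and it is free and transitive.
   Context: $Y=\{z_k:k\in\mathbb Z\}$, and $\mathcal H=\langle Y\rangle_{\mathbb Q}$ is the $\mathbb Q$-vector space spanned by words in $Y$ (empty word $\mathbf 1$), equipped with the quasi-shuffle product $\ast$ defined by $\mathbf 1\ast w=w\ast\mathbf 1=w$ and $z_mu\ast z_nv=z_m(u\ast z_nv)+z_n(z_mu\ast v)+z_{m+n}(u\ast v)$; deconcatenation coproduct $\Delta(w)=\sum_{uv=w}u\otimes v$; counit $\varepsilon(\mathbf 1)=1$, $\varepsilon(w)=0$ for nonempty $w$; this is a Hopf algebra. A word $z_{k_1}\cdots z_{k_n}$ ($n\ge1$) is non-singular if $k_1\neq1$, $k_1+k_2\notin\{2,1,0,-2,-4,\ldots\}$ (when $n\ge2$), and $k_1+\cdots+k_j\notin\mathbb Z_{\le j}$ for all $3\le j\le n$; $N$ is the $\mathbb Q$-span of non-singular words. $G_{\mathcal A}$ is the group of unital algebra morphisms $(\mathcal H,\ast)\to\mathcal A$ under the convolution $\phi\star\psi=m_{\mathcal A}\circ(\phi\otimes\psi)\circ\Delta$,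 with unit $e=u_{\mathcal A}\circ\varepsilon$. The transfer group is $T_{\mathcal A}=\{\phi\in G_{\mathcal A}:\phi|_N=0\}$, a subgroup of $G_{\mathcal A}$. -}

module Defs where

open import Level using (Level; _⊔_)
open import Data.Nat using (ℕ; zero; suc)
open import Data.Integer using (ℤ; +_; -_) renaming (_+_ to _+ℤ_; _<_ to _<ℤ_)
open import Data.List using (List; []; _∷_; map; _++_)
open import Data.Product using (_×_; _,_; ∃)
open import Data.Sum using (_⊎_)
open import Data.Unit using (⊤)
open import Data.Empty using (⊥)
open import Relation.Nullary using (¬_)
open import Relation.Binary.PropositionalEquality using (_≡_; _≢_)
open import Algebra.Bundles using (CommutativeRing)
open import Algebra.Morphism.Structures using (module RingMorphisms)
open import Data.Rational using (ℚ)
import Data.Rational.Properties as ℚP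

-- Words in the alphabet Y = { z_k : k ∈ ℤ }; the word z_{k1}⋯z_{kn} is
-- the list k1 ∷ ⋯ ∷ kn ∷ [].  The empty word is the unit 𝟏.

Word : Set
Word = List ℤ

-- Quasi-shuffle product of two words, as a formal sum of words with
-- multiplicity (all coefficients are natural numbers), i.e. a list of
-- words.  z_m u ∗ z_n v = z_m (u ∗ z_n v) + z_n (z_m u ∗ v) + z_{m+n} (u ∗ v).
_∗_ : Word → Word → List Word
[] ∗ w = w ∷ []
(m ∷ u) ∗ [] = (m ∷ u) ∷ []
(m ∷ u) ∗ (n ∷ v) =
  map (m ∷_) (u ∗ (n ∷ v)) ++ (map (n ∷_) ((m ∷ u) ∗ v) ++ map ((m +ℤ n) ∷_) (u ∗ v))

splits : Word → List (Word × Word)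
splits [] = ([] , []) ∷ []
splits (k ∷ w) = ([] , k ∷ w) ∷ map (λ { (u , v) → (k ∷ u , v) }) (splits w)

Bad2 : ℤ → Set
Bad2 s = s ≡ + 2 ⊎ (s ≡ + 1 ⊎ (s ≡ + 0 ⊎ ∃ λ (k : ℕ) → s ≡ - (+ (2 Data.Nat.* suc k))))

-- condition on the j-th partial sum s = k1 + ⋯ + kj, for j ≥ 2
PartialOK : ℕ → ℤ → Set
PartialOK (suc (suc (suc j))) s = + (suc (suc (suc j))) <ℤ s
PartialOK (suc (suc zero)) s = ¬ Bad2 s
PartialOK _ s = ⊤

-- conditions on positions j+1, j+2, … given partial sum s up to position j
TailOK : ℕ → ℤ → List ℤ → Set
TailOK j s [] = ⊤
TailOK j s (k ∷ ks) = PartialOK (suc j) (s +ℤ k) × TailOK (suc j) (s +ℤ k) ks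

NonSingular : Word → Set
NonSingular [] = ⊥
NonSingular (k₁ ∷ ks) = k₁ ≢ + 1 × TailOK 1 k₁ ks

record QAlgebra (c ℓ : Level) : Set (Level.suc (c ⊔ ℓ)) where
  field
    commRing : CommutativeRing c ℓ
  open CommutativeRing commRing public
  field
    ι : ℚ → Carrier
    ι-isRingHomomorphism :
      RingMorphisms.IsRingHomomorphism ℚP.+-*-rawRing rawRing ι

module _ {c ℓ : Level} (A : QAlgebra c ℓ) where
  open QAlgebra A

  -- A ℚ-linear map ℋ → A is determined by its values on the basis of
  -- words; we represent it by that function.
  LinMap : Set c
  LinMap = Word → Carrier

  lin : LinMap → List Word → Carrier
  lin φ [] = 0#
  lin φ (w ∷ ws) = φ w + lin φ ws

  IsCharacter : LinMap → Set ℓ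
  IsCharacter φ = (φ [] ≈ 1#) × (∀ u v → lin φ (u ∗ v) ≈ φ u * φ v)

  -- convolution  φ ⋆ ψ = m_A ∘ (φ ⊗ ψ) ∘ Δ
  sumSplits : LinMap → LinMap → List (Word × Word) → Carrier
  sumSplits φ ψ [] = 0#
  sumSplits φ ψ ((u , v) ∷ ps) = φ u * ψ v + sumSplits φ ψ ps

  _⋆_ : LinMap → LinMap → LinMap
  (φ ⋆ ψ) w = sumSplits φ ψ (splits w)

  e : LinMap
  e [] = 1#
  e (_ ∷ _) = 0#

  _≋_ : LinMap → LinMap → Set ℓ
  φ ≋ ψ = ∀ w → φ w ≈ ψ w

  -- a linear map N → A, given by its values on the basis of
  -- non-singular words
  PartialMap : Set c
  PartialMap = (w : Word) → NonSingular w → Carrier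

  InT : LinMap → Set ℓ
  InT φ = IsCharacter φ × (∀ w → NonSingular w → φ w ≈ 0#)

  InX : PartialMap → LinMap → Set ℓ
  InX ζ α = IsCharacter α × (∀ w (p : NonSingular w) → α w ≈ ζ w p)

{-# OPTIONS --safe #-}
module Submission where

-- Convolution makes the characters of (ℋ, ∗) a group. Deconcatenation is multiplicative for the
-- quasi-shuffle, so ⋆ preserves characters; the convolution inverse α⁻¹ of a character is again a
-- character, because (x , y) ↦ α⁻¹ (x ∗ y) and (x , y) ↦ α⁻¹ x α⁻¹ y both solve the equation
-- (α ∘ ∗) ⋆ H = e ⊗ e on ℋ ⊗ ℋ, whose solution is unique. Since N is closed under non-empty
-- prefixes, (φ ⋆ α) w for w ∈ N only involves φ on N ∪ {𝟏}: so φ ⋆ α agrees with α on N when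
-- φ ∈ T, and β ⋆ α⁻¹ agrees with α ⋆ α⁻¹ = e on N when α, β ∈ X. Freeness is cancellation.

open import Defs
open import Level using (Level)
open import Data.Product using (_×_; ∃; _,_)
open import Data.List using ([]; _∷_; map; _++_; length)
open import Data.List.Properties using (length-++-≤ʳ)
open import Data.Nat using (ℕ; suc; _≤_; _<_; s≤s) renaming (_+_ to _+ℕ_)
open import Data.Nat.Properties using (+-monoʳ-<; +-mono-<-≤)
open import Data.Nat.Induction using (<-wellFounded)
open import Data.Integer using (ℤ) renaming (_+_ to _+ℤ_)
open import Induction.WellFounded using (module All)
open import Relation.Binary.Construct.On using () renaming (wellFounded to on-wellFounded)
import Relation.Binary.PropositionalEquality as ≡
open ≡ using (_≡_)

suffix-≤ : ∀ (a b : Word) {w} → a ++ b ≡ w → length b ≤ length w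
suffix-≤ a b ≡.refl = length-++-≤ʳ b {a}

properSuffix-< : ∀ k (a b : Word) {w} → (k ∷ a) ++ b ≡ w → length b < length w
properSuffix-< k a b ≡.refl = s≤s (length-++-≤ʳ b {a})

tailOK-prefix : ∀ j s (a b : Word) → TailOK j s (a ++ b) → TailOK j s a
tailOK-prefix j s [] b _ = _
tailOK-prefix j s (k ∷ a) b (ok , oks) = ok , tailOK-prefix (suc j) (s +ℤ k) a b oks

nonSingular-prefix : ∀ k (a b : Word) → NonSingular ((k ∷ a) ++ b) → NonSingular (k ∷ a)
nonSingular-prefix k a b (k≢1 , oks) = k≢1 , tailOK-prefix 1 k a b oks

module _ {c ℓ : Level} (A : QAlgebra c ℓ) where
  open QAlgebra A
  open import Relation.Binary.Reasoning.Setoid setoid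
  open import Algebra.Properties.CommutativeSemigroup +-commutativeSemigroup
    using (x∙yz≈y∙xz) renaming (interchange to +-interchange)
  open import Algebra.Properties.CommutativeSemigroup *-commutativeSemigroup
    using () renaming (interchange to *-interchange)
  open import Algebra.Properties.Group +-group using () renaming (∙-cancelʳ to +-cancelʳ)

  ∂[_]_ : ℤ → LinMap A → LinMap A
  (∂[ k ] f) w = f (k ∷ w)

  splitSum : (Word → Word → Carrier) → Word → Carrier
  splitSum F [] = F [] []
  splitSum F (k ∷ w) = F [] (k ∷ w) + splitSum (λ a b → F (k ∷ a) b) w

  splitSum⁺ : (Word → Word → Carrier) → Word → Carrier
  splitSum⁺ F [] = 0#
  splitSum⁺ F (k ∷ w) = splitSum (λ a b → F (k ∷ a) b) w

  splitSum-unfold : ∀ F w → splitSum F w ≈ F [] w + splitSum⁺ F w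
  splitSum-unfold F [] = sym (+-identityʳ _)
  splitSum-unfold F (k ∷ w) = refl

  splitSum-cong-on : ∀ {F G} w → (∀ a b → a ++ b ≡ w → F a b ≈ G a b) →
                     splitSum F w ≈ splitSum G w
  splitSum-cong-on [] F≈G = F≈G [] [] ≡.refl
  splitSum-cong-on (k ∷ w) F≈G =
    +-cong (F≈G [] (k ∷ w) ≡.refl)
           (splitSum-cong-on w (λ a b eq → F≈G (k ∷ a) b (≡.cong (k ∷_) eq)))

  splitSum⁺-cong-on : ∀ {F G} w → (∀ k a b → (k ∷ a) ++ b ≡ w → F (k ∷ a) b ≈ G (k ∷ a) b) →
                      splitSum⁺ F w ≈ splitSum⁺ G w
  splitSum⁺-cong-on [] F≈G = refl
  splitSum⁺-cong-on (k ∷ w) F≈G = splitSum-cong-on w (λ a b eq → F≈G k a b (≡.cong (k ∷_) eq))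

  splitSum-cong : ∀ {F G} → (∀ a b → F a b ≈ G a b) → ∀ w → splitSum F w ≈ splitSum G w
  splitSum-cong F≈G w = splitSum-cong-on w (λ a b _ → F≈G a b)

  splitSum-vanishes : ∀ {F} w → (∀ a b → a ++ b ≡ w → F a b ≈ 0#) → splitSum F w ≈ 0#
  splitSum-vanishes [] F≈0 = F≈0 [] [] ≡.refl
  splitSum-vanishes (k ∷ w) F≈0 =
    trans (+-cong (F≈0 [] (k ∷ w) ≡.refl)
                  (splitSum-vanishes w (λ a b eq → F≈0 (k ∷ a) b (≡.cong (k ∷_) eq))))
          (+-identityʳ 0#)

  splitSum-+ : ∀ F G w → splitSum (λ a b → F a b + G a b) w ≈ splitSum F w + splitSum G w
  splitSum-+ F G [] = refl
  splitSum-+ F G (k ∷ w) =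
    trans (+-congˡ (splitSum-+ (λ a b → F (k ∷ a) b) (λ a b → G (k ∷ a) b) w))
          (+-interchange _ _ _ _)

  splitSum-*ˡ : ∀ x F w → x * splitSum F w ≈ splitSum (λ a b → x * F a b) w
  splitSum-*ˡ x F [] = refl
  splitSum-*ˡ x F (k ∷ w) =
    trans (distribˡ x _ _) (+-congˡ (splitSum-*ˡ x (λ a b → F (k ∷ a) b) w))

  splitSum-*ʳ : ∀ x F w → splitSum F w * x ≈ splitSum (λ a b → F a b * x) w
  splitSum-*ʳ x F [] = refl
  splitSum-*ʳ x F (k ∷ w) =
    trans (distribʳ x _ _) (+-congˡ (splitSum-*ʳ x (λ a b → F (k ∷ a) b) w))

  lin-cong : ∀ {f g : LinMap A} → (∀ w → f w ≈ g w) → ∀ ws → lin A f ws ≈ lin A g ws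
  lin-cong f≈g [] = refl
  lin-cong f≈g (w ∷ ws) = +-cong (f≈g w) (lin-cong f≈g ws)

  lin-vanishes : ∀ (f : LinMap A) → (∀ w → f w ≈ 0#) → ∀ ws → lin A f ws ≈ 0#
  lin-vanishes f f≈0 [] = refl
  lin-vanishes f f≈0 (w ∷ ws) = trans (+-cong (f≈0 w) (lin-vanishes f f≈0 ws)) (+-identityʳ 0#)

  lin-singleton : ∀ (f : LinMap A) w → lin A f (w ∷ []) ≈ f w
  lin-singleton f w = +-identityʳ _

  lin-++ : ∀ (f : LinMap A) xs ys → lin A f (xs ++ ys) ≈ lin A f xs + lin A f ys
  lin-++ f [] ys = sym (+-identityˡ _)
  lin-++ f (x ∷ xs) ys = trans (+-congˡ (lin-++ f xs ys)) (sym (+-assoc _ _ _))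

  lin-map-∷ : ∀ (f : LinMap A) k ws → lin A f (map (k ∷_) ws) ≡ lin A (∂[ k ] f) ws
  lin-map-∷ f k [] = ≡.refl
  lin-map-∷ f k (w ∷ ws) = ≡.cong (f (k ∷ w) +_) (lin-map-∷ f k ws)

  lin-+ : ∀ (f g : LinMap A) ws → lin A (λ w → f w + g w) ws ≈ lin A f ws + lin A g ws
  lin-+ f g [] = sym (+-identityˡ _)
  lin-+ f g (w ∷ ws) = trans (+-congˡ (lin-+ f g ws)) (+-interchange _ _ _ _)

  lin-*ˡ : ∀ x (f : LinMap A) ws → x * lin A f ws ≈ lin A (λ w → x * f w) ws
  lin-*ˡ x f [] = zeroʳ x
  lin-*ˡ x f (w ∷ ws) = trans (distribˡ x _ _) (+-congˡ (lin-*ˡ x f ws))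

  lin-∗-[] : ∀ (f : LinMap A) x → lin A f (x ∗ []) ≈ f x
  lin-∗-[] f [] = lin-singleton f []
  lin-∗-[] f (k ∷ x) = lin-singleton f (k ∷ x)

  lin-∗-∷ : ∀ (f : LinMap A) m u n v →
    lin A f ((m ∷ u) ∗ (n ∷ v)) ≈
      lin A (∂[ m ] f) (u ∗ (n ∷ v)) + (lin A (∂[ n ] f) ((m ∷ u) ∗ v) + lin A (∂[ m +ℤ n ] f) (u ∗ v))
  lin-∗-∷ f m u n v = begin
    lin A f ((m ∷ u) ∗ (n ∷ v))
      ≈⟨ lin-++ f (map (m ∷_) (u ∗ (n ∷ v))) _ ⟩
    lin A f (map (m ∷_) (u ∗ (n ∷ v))) + lin A f (map (n ∷_) ((m ∷ u) ∗ v) ++ map ((m +ℤ n) ∷_) (u ∗ v))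
      ≈⟨ +-congˡ (lin-++ f (map (n ∷_) ((m ∷ u) ∗ v)) _) ⟩
    lin A f (map (m ∷_) (u ∗ (n ∷ v))) + (lin A f (map (n ∷_) ((m ∷ u) ∗ v)) + lin A f (map ((m +ℤ n) ∷_) (u ∗ v)))
      ≡⟨ ≡.cong₂ _+_ (lin-map-∷ f m (u ∗ (n ∷ v)))
                        (≡.cong₂ _+_ (lin-map-∷ f n ((m ∷ u) ∗ v)) (lin-map-∷ f (m +ℤ n) (u ∗ v))) ⟩
    lin A (∂[ m ] f) (u ∗ (n ∷ v)) + (lin A (∂[ n ] f) ((m ∷ u) ∗ v) + lin A (∂[ m +ℤ n ] f) (u ∗ v)) ∎

  conv : LinMap A → LinMap A → LinMap A
  conv g h = splitSum (λ a b → g a * h b)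

  sumSplits-map-∷ : ∀ (g h : LinMap A) k ps →
    sumSplits A g h (map (λ { (u , v) → (k ∷ u , v) }) ps) ≡ sumSplits A (∂[ k ] g) h ps
  sumSplits-map-∷ g h k [] = ≡.refl
  sumSplits-map-∷ g h k ((u , v) ∷ ps) = ≡.cong (g (k ∷ u) * h v +_) (sumSplits-map-∷ g h k ps)

  ⋆≈conv : ∀ (g h : LinMap A) w → _⋆_ A g h w ≈ conv g h w
  ⋆≈conv g h [] = +-identityʳ _
  ⋆≈conv g h (k ∷ w) =
    +-congˡ (trans (reflexive (sumSplits-map-∷ g h k (splits w))) (⋆≈conv (∂[ k ] g) h w))

  conv-cong : ∀ {g g′ h h′ : LinMap A} → (∀ w → g w ≈ g′ w) → (∀ w → h w ≈ h′ w) →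
              ∀ w → conv g h w ≈ conv g′ h′ w
  conv-cong g≈g′ h≈h′ = splitSum-cong (λ a b → *-cong (g≈g′ a) (h≈h′ b))

  conv-congˡ-on-prefixes : ∀ {g g′ : LinMap A} h w → (∀ a b → a ++ b ≡ w → g a ≈ g′ a) →
                           conv g h w ≈ conv g′ h w
  conv-congˡ-on-prefixes h w g≈g′ = splitSum-cong-on w (λ a b eq → *-congʳ (g≈g′ a b eq))

  conv-identityʳ : ∀ (f : LinMap A) w → conv f (e A) w ≈ f w
  conv-identityʳ f [] = *-identityʳ _
  conv-identityʳ f (k ∷ w) =
    trans (+-cong (zeroʳ (f [])) (conv-identityʳ (∂[ k ] f) w)) (+-identityˡ _)

  conv-identityˡ : ∀ (f : LinMap A) w → conv (e A) f w ≈ f w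
  conv-identityˡ f [] = *-identityˡ _
  conv-identityˡ f (k ∷ w) =
    trans (+-cong (*-identityˡ _) (splitSum-vanishes w (λ a b _ → zeroˡ (f b)))) (+-identityʳ _)

  conv-assoc : ∀ (f g h : LinMap A) w → conv (conv f g) h w ≈ conv f (conv g h) w
  conv-assoc f g h [] = *-assoc _ _ _
  conv-assoc f g h (k ∷ w) = begin
    (f [] * g []) * h (k ∷ w) + splitSum (λ a b → (f [] * g (k ∷ a) + conv (∂[ k ] f) g a) * h b) w
      ≈⟨ +-congˡ (trans (splitSum-cong (λ a b → distribʳ (h b) _ _) w) (splitSum-+ _ _ w)) ⟩
    (f [] * g []) * h (k ∷ w) + (splitSum (λ a b → (f [] * g (k ∷ a)) * h b) w + conv (conv (∂[ k ] f) g) h w)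
      ≈⟨ +-congˡ (+-cong (trans (splitSum-cong (λ a b → *-assoc _ _ _) w) (sym (splitSum-*ˡ (f []) _ w)))
                         (conv-assoc (∂[ k ] f) g h w)) ⟩
    (f [] * g []) * h (k ∷ w) + (f [] * splitSum (λ a b → g (k ∷ a) * h b) w + conv (∂[ k ] f) (conv g h) w)
      ≈⟨ sym (+-assoc _ _ _) ⟩
    ((f [] * g []) * h (k ∷ w) + f [] * splitSum (λ a b → g (k ∷ a) * h b) w) + conv (∂[ k ] f) (conv g h) w
      ≈⟨ +-congʳ (trans (+-congʳ (*-assoc _ _ _)) (sym (distribˡ (f []) _ _))) ⟩
    f [] * conv g h (k ∷ w) + conv (∂[ k ] f) (conv g h) w ∎

  lin-∂-conv : ∀ (g h : LinMap A) k ws →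
    lin A (∂[ k ] (conv g h)) ws ≈ g [] * lin A (∂[ k ] h) ws + lin A (conv (∂[ k ] g) h) ws
  lin-∂-conv g h k ws =
    trans (lin-+ _ _ ws) (+-congʳ (sym (lin-*ˡ (g []) (∂[ k ] h) ws)))

  _∘∗ : LinMap A → Word → Word → Carrier
  (f ∘∗) x y = lin A f (x ∗ y)

  -- convolution on ℋ ⊗ ℋ, a bilinear map being given by its values on pairs of words
  conv₂ : (Word → Word → Carrier) → (Word → Word → Carrier) → Word → Word → Carrier
  conv₂ F G x y = splitSum (λ x₁ x₂ → splitSum (λ y₁ y₂ → F x₁ y₁ * G x₂ y₂) y) x

  conv₂-unfold : ∀ F G x y →
    conv₂ F G x y ≈ F [] [] * G x y + (splitSum⁺ (λ y₁ y₂ → F [] y₁ * G x y₂) y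
                      + splitSum⁺ (λ x₁ x₂ → splitSum (λ y₁ y₂ → F x₁ y₁ * G x₂ y₂) y) x)
  conv₂-unfold F G x y =
    trans (splitSum-unfold _ x) (trans (+-congʳ (splitSum-unfold _ y)) (+-assoc _ _ _))

  conv₂-⊗ : ∀ (g g′ h h′ : LinMap A) x y →
    conv₂ (λ a b → g a * g′ b) (λ a b → h a * h′ b) x y ≈ conv g h x * conv g′ h′ y
  conv₂-⊗ g g′ h h′ x y = begin
    conv₂ (λ a b → g a * g′ b) (λ a b → h a * h′ b) x y
      ≈⟨ splitSum-cong (λ x₁ x₂ → splitSum-cong (λ y₁ y₂ → *-interchange _ _ _ _) y) x ⟩
    splitSum (λ x₁ x₂ → splitSum (λ y₁ y₂ → (g x₁ * h x₂) * (g′ y₁ * h′ y₂)) y) x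
      ≈⟨ splitSum-cong (λ x₁ x₂ → sym (splitSum-*ˡ _ _ y)) x ⟩
    splitSum (λ x₁ x₂ → (g x₁ * h x₂) * conv g′ h′ y) x
      ≈⟨ sym (splitSum-*ʳ _ _ x) ⟩
    conv g h x * conv g′ h′ y ∎

  conv₂-∘∗-∷ : ∀ (g : LinMap A) H m u n v →
    conv₂ (g ∘∗) H (m ∷ u) (n ∷ v) ≈
      g [] * H (m ∷ u) (n ∷ v) + (conv₂ ((∂[ m ] g) ∘∗) H u (n ∷ v)
        + (conv₂ ((∂[ n ] g) ∘∗) H (m ∷ u) v + conv₂ ((∂[ m +ℤ n ] g) ∘∗) H u v))
  conv₂-∘∗-∷ g H m u n v = begin
    (g[]H + I) + splitSum (λ x₁ x₂ → Row (m ∷ x₁) x₂) u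
      ≈⟨ +-cong (+-congʳ (*-congʳ (lin-singleton g []))) (trans (splitSum-cong rowSplit u)
                (trans (splitSum-+ Rowₘ _ u) (+-congˡ (splitSum-+ Rowₙ Rowₘₙ u)))) ⟩
    (g [] * H x y + I) + (splitSum Rowₘ u + (splitSum Rowₙ u + splitSum Rowₘₙ u))
      ≈⟨ trans (+-assoc _ _ _) (+-congˡ (trans (x∙yz≈y∙xz _ _ _) (+-congˡ (sym (+-assoc _ _ _))))) ⟩
    g [] * H x y + (splitSum Rowₘ u + ((I + splitSum Rowₙ u) + splitSum Rowₘₙ u)) ∎
    where
    x = m ∷ u
    y = n ∷ v
    g[]H = lin A g ([] ∗ []) * H x y
    I = splitSum (λ y₁ y₂ → lin A g ([] ∗ (n ∷ y₁)) * H x y₂) v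
    Row : Word → Word → Carrier
    Row x₁ x₂ = splitSum (λ y₁ y₂ → lin A g (x₁ ∗ y₁) * H x₂ y₂) y
    Rowₘ Rowₙ Rowₘₙ : Word → Word → Carrier
    Rowₘ x₁ x₂ = splitSum (λ y₁ y₂ → lin A (∂[ m ] g) (x₁ ∗ y₁) * H x₂ y₂) y
    Rowₙ x₁ x₂ = splitSum (λ y₁ y₂ → lin A (∂[ n ] g) ((m ∷ x₁) ∗ y₁) * H x₂ y₂) v
    Rowₘₙ x₁ x₂ = splitSum (λ y₁ y₂ → lin A (∂[ m +ℤ n ] g) (x₁ ∗ y₁) * H x₂ y₂) v
    rowSplit : ∀ x₁ x₂ → Row (m ∷ x₁) x₂ ≈ Rowₘ x₁ x₂ + (Rowₙ x₁ x₂ + Rowₘₙ x₁ x₂)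
    rowSplit x₁ x₂ = begin
      lin A g ((m ∷ x₁) ∗ []) * H x₂ y + splitSum (λ y₁ y₂ → lin A g ((m ∷ x₁) ∗ (n ∷ y₁)) * H x₂ y₂) v
        ≈⟨ +-congˡ (splitSum-cong (λ y₁ y₂ → trans (*-congʳ (lin-∗-∷ g m x₁ n y₁))
                      (trans (distribʳ _ _ _) (+-congˡ (distribʳ _ _ _)))) v) ⟩
      lin A g ((m ∷ x₁) ∗ []) * H x₂ y + splitSum (λ y₁ y₂ → Tₘ y₁ y₂ + (Tₙ y₁ y₂ + Tₘₙ y₁ y₂)) v
        ≈⟨ +-congˡ (trans (splitSum-+ Tₘ _ v) (+-congˡ (splitSum-+ Tₙ Tₘₙ v))) ⟩
      lin A g ((m ∷ x₁) ∗ []) * H x₂ y + (splitSum Tₘ v + (splitSum Tₙ v + splitSum Tₘₙ v))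
        ≈⟨ sym (+-assoc _ _ _) ⟩
      (lin A g ((m ∷ x₁) ∗ []) * H x₂ y + splitSum Tₘ v) + (splitSum Tₙ v + splitSum Tₘₙ v)
        ≈⟨ +-congʳ (+-congʳ (*-congʳ (trans (lin-∗-[] g (m ∷ x₁)) (sym (lin-∗-[] (∂[ m ] g) x₁))))) ⟩
      Rowₘ x₁ x₂ + (Rowₙ x₁ x₂ + Rowₘₙ x₁ x₂) ∎
      where
      Tₘ Tₙ Tₘₙ : Word → Word → Carrier
      Tₘ y₁ y₂ = lin A (∂[ m ] g) (x₁ ∗ (n ∷ y₁)) * H x₂ y₂
      Tₙ y₁ y₂ = lin A (∂[ n ] g) ((m ∷ x₁) ∗ y₁) * H x₂ y₂
      Tₘₙ y₁ y₂ = lin A (∂[ m +ℤ n ] g) (x₁ ∗ y₁) * H x₂ y₂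

  lin-conv-∗ : ∀ x y (g h : LinMap A) → lin A (conv g h) (x ∗ y) ≈ conv₂ (g ∘∗) (h ∘∗) x y
  lin-conv-∗ [] y g h =
    trans (lin-singleton (conv g h) y)
          (splitSum-cong (λ a b → sym (*-cong (lin-singleton g a) (lin-singleton h b))) y)
  lin-conv-∗ (m ∷ u) [] g h =
    trans (lin-singleton (conv g h) (m ∷ u))
          (splitSum-cong (λ a b → sym (*-cong (lin-∗-[] g a) (lin-∗-[] h b))) (m ∷ u))
  lin-conv-∗ (m ∷ u) (n ∷ v) g h = begin
    lin A (conv g h) (x ∗ y)
      ≈⟨ trans (lin-∗-∷ (conv g h) m u n v)
               (+-cong (lin-∂-conv g h m (u ∗ y))
                       (+-cong (lin-∂-conv g h n (x ∗ v)) (lin-∂-conv g h mn (u ∗ v)))) ⟩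
    (g [] * Hₘ + Lₘ) + ((g [] * Hₙ + Lₙ) + (g [] * Hₘₙ + Lₘₙ))
      ≈⟨ trans (+-congˡ (+-interchange _ _ _ _)) (+-interchange _ _ _ _) ⟩
    (g [] * Hₘ + (g [] * Hₙ + g [] * Hₘₙ)) + (Lₘ + (Lₙ + Lₘₙ))
      ≈⟨ +-cong leading (+-cong (lin-conv-∗ u (n ∷ v) (∂[ m ] g) h)
                          (+-cong (lin-conv-∗ (m ∷ u) v (∂[ n ] g) h) (lin-conv-∗ u v (∂[ mn ] g) h))) ⟩
    g [] * lin A h (x ∗ y) + (conv₂ ((∂[ m ] g) ∘∗) (h ∘∗) u y
      + (conv₂ ((∂[ n ] g) ∘∗) (h ∘∗) x v + conv₂ ((∂[ mn ] g) ∘∗) (h ∘∗) u v))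
      ≈⟨ sym (conv₂-∘∗-∷ g (h ∘∗) m u n v) ⟩
    conv₂ (g ∘∗) (h ∘∗) x y ∎
    where
    x = m ∷ u
    y = n ∷ v
    mn = m +ℤ n
    Hₘ = lin A (∂[ m ] h) (u ∗ y)
    Hₙ = lin A (∂[ n ] h) (x ∗ v)
    Hₘₙ = lin A (∂[ mn ] h) (u ∗ v)
    Lₘ = lin A (conv (∂[ m ] g) h) (u ∗ y)
    Lₙ = lin A (conv (∂[ n ] g) h) (x ∗ v)
    Lₘₙ = lin A (conv (∂[ mn ] g) h) (u ∗ v)
    leading : g [] * Hₘ + (g [] * Hₙ + g [] * Hₘₙ) ≈ g [] * lin A h (x ∗ y)
    leading = trans (trans (+-congˡ (sym (distribˡ _ _ _))) (sym (distribˡ _ _ _)))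
                    (*-congˡ (sym (lin-∗-∷ h m u n v)))

  IsMultiplicative : LinMap A → Set ℓ
  IsMultiplicative f = ∀ a b → lin A f (a ∗ b) ≈ f a * f b

  conv-multiplicative : ∀ (g h : LinMap A) → IsMultiplicative g → IsMultiplicative h →
                        IsMultiplicative (conv g h)
  conv-multiplicative g h g-mult h-mult x y = begin
    lin A (conv g h) (x ∗ y)
      ≈⟨ lin-conv-∗ x y g h ⟩
    conv₂ (g ∘∗) (h ∘∗) x y
      ≈⟨ splitSum-cong (λ x₁ x₂ → splitSum-cong (λ y₁ y₂ → *-cong (g-mult x₁ y₁) (h-mult x₂ y₂)) y) x ⟩
    conv₂ (λ a b → g a * g b) (λ a b → h a * h b) x y
      ≈⟨ conv₂-⊗ g g h h x y ⟩
    conv g h x * conv g h y ∎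

  e-multiplicative : IsMultiplicative (e A)
  e-multiplicative [] y = trans (lin-singleton (e A) y) (sym (*-identityˡ _))
  e-multiplicative (m ∷ u) [] = trans (lin-singleton (e A) (m ∷ u)) (sym (zeroˡ _))
  e-multiplicative (m ∷ u) (n ∷ v) = begin
    lin A (e A) ((m ∷ u) ∗ (n ∷ v))
      ≈⟨ lin-∗-∷ (e A) m u n v ⟩
    lin A (∂[ m ] e A) (u ∗ (n ∷ v)) + (lin A (∂[ n ] e A) ((m ∷ u) ∗ v) + lin A (∂[ m +ℤ n ] e A) (u ∗ v))
      ≈⟨ +-cong (lin-vanishes _ (λ _ → refl) (u ∗ (n ∷ v)))
                (+-cong (lin-vanishes _ (λ _ → refl) ((m ∷ u) ∗ v)) (lin-vanishes _ (λ _ → refl) (u ∗ v))) ⟩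
    0# + (0# + 0#)
      ≈⟨ trans (+-identityˡ _) (trans (+-identityˡ 0#) (sym (zeroˡ 0#))) ⟩
    0# * 0# ∎

  ⋆-isCharacter : ∀ (g h : LinMap A) → IsCharacter A g → IsCharacter A h → IsCharacter A (_⋆_ A g h)
  ⋆-isCharacter g h (g[]≈1 , g-mult) (h[]≈1 , h-mult) =
    trans (⋆≈conv g h []) (trans (*-cong g[]≈1 h[]≈1) (*-identityˡ 1#)) ,
    λ x y → trans (lin-cong (⋆≈conv g h) (x ∗ y))
              (trans (conv-multiplicative g h g-mult h-mult x y)
                     (sym (*-cong (⋆≈conv g h x) (⋆≈conv g h y))))

  module _ (α : LinMap A) where
    mutual
      inverse : LinMap A
      inverse [] = 1#
      inverse (k ∷ w) = - convInverse (∂[ k ] α) w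

      -- convInverse f is conv f inverse, unfolded so that the recursion is structural.
      convInverse : LinMap A → Word → Carrier
      convInverse f [] = f [] * inverse []
      convInverse f (j ∷ w) = f [] * inverse (j ∷ w) + convInverse (∂[ j ] f) w

    convInverse≡conv : ∀ f w → convInverse f w ≡ conv f inverse w
    convInverse≡conv f [] = ≡.refl
    convInverse≡conv f (j ∷ w) = ≡.cong (f [] * inverse (j ∷ w) +_) (convInverse≡conv (∂[ j ] f) w)

    conv-inverseʳ : α [] ≈ 1# → ∀ w → conv α inverse w ≈ e A w
    conv-inverseʳ α[]≈1 [] = trans (*-identityʳ _) α[]≈1
    conv-inverseʳ α[]≈1 (k ∷ w) = begin
      α [] * - convInverse (∂[ k ] α) w + conv (∂[ k ] α) inverse w
        ≈⟨ +-cong (trans (*-congʳ α[]≈1) (*-identityˡ _))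
                  (reflexive (≡.sym (convInverse≡conv (∂[ k ] α) w))) ⟩
      - convInverse (∂[ k ] α) w + convInverse (∂[ k ] α) w
        ≈⟨ -‿inverseˡ _ ⟩
      0# ∎

  ⋆-cong : ∀ {φ φ′ ψ ψ′ : LinMap A} → _≋_ A φ φ′ → _≋_ A ψ ψ′ → _≋_ A (_⋆_ A φ ψ) (_⋆_ A φ′ ψ′)
  ⋆-cong φ≋φ′ ψ≋ψ′ w = trans (⋆≈conv _ _ w) (trans (conv-cong φ≋φ′ ψ≋ψ′ w) (sym (⋆≈conv _ _ w)))

  ⋆-identityˡ : ∀ φ → _≋_ A (_⋆_ A (e A) φ) φ
  ⋆-identityˡ φ w = trans (⋆≈conv (e A) φ w) (conv-identityˡ φ w)

  ⋆-identityʳ : ∀ φ → _≋_ A (_⋆_ A φ (e A)) φ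
  ⋆-identityʳ φ w = trans (⋆≈conv φ (e A) w) (conv-identityʳ φ w)

  ⋆-assoc : ∀ φ ψ χ → _≋_ A (_⋆_ A (_⋆_ A φ ψ) χ) (_⋆_ A φ (_⋆_ A ψ χ))
  ⋆-assoc φ ψ χ w = begin
    _⋆_ A (_⋆_ A φ ψ) χ w ≈⟨ trans (⋆≈conv _ χ w) (conv-cong (⋆≈conv φ ψ) (λ _ → refl) w) ⟩
    conv (conv φ ψ) χ w   ≈⟨ conv-assoc φ ψ χ w ⟩
    conv φ (conv ψ χ) w   ≈⟨ sym (trans (⋆≈conv φ _ w) (conv-cong (λ _ → refl) (⋆≈conv ψ χ) w)) ⟩
    _⋆_ A φ (_⋆_ A ψ χ) w ∎

  ⋆-inverseʳ : ∀ α → α [] ≈ 1# → _≋_ A (_⋆_ A α (inverse α)) (e A)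
  ⋆-inverseʳ α α[]≈1 w = trans (⋆≈conv α (inverse α) w) (conv-inverseʳ α α[]≈1 w)

  -- The right inverse α′ of inverse α equals α, as in any monoid with right inverses.
  ⋆-inverseˡ : ∀ α → α [] ≈ 1# → _≋_ A (_⋆_ A (inverse α) α) (e A)
  ⋆-inverseˡ α α[]≈1 w = begin
    _⋆_ A α⁻¹ α w  ≈⟨ ⋆-cong (λ _ → refl) α≋α′ w ⟩
    _⋆_ A α⁻¹ α′ w ≈⟨ ⋆-inverseʳ α⁻¹ refl w ⟩
    e A w          ∎
    where
    α⁻¹ = inverse α
    α′ = inverse α⁻¹
    α≋α′ : _≋_ A α α′
    α≋α′ u = begin
      α u                         ≈⟨ sym (⋆-identityʳ α u) ⟩
      _⋆_ A α (e A) u             ≈⟨ ⋆-cong (λ _ → refl) (λ v → sym (⋆-inverseʳ α⁻¹ refl v)) u ⟩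
      _⋆_ A α (_⋆_ A α⁻¹ α′) u    ≈⟨ sym (⋆-assoc α α⁻¹ α′ u) ⟩
      _⋆_ A (_⋆_ A α α⁻¹) α′ u    ≈⟨ ⋆-cong (⋆-inverseʳ α α[]≈1) (λ _ → refl) u ⟩
      _⋆_ A (e A) α′ u            ≈⟨ ⋆-identityˡ α′ u ⟩
      α′ u                        ∎

  ⋆-cancelʳ : ∀ {φ ψ} α → α [] ≈ 1# → _≋_ A (_⋆_ A φ α) (_⋆_ A ψ α) → _≋_ A φ ψ
  ⋆-cancelʳ {φ} {ψ} α α[]≈1 φα≋ψα w = begin
    φ w                                        ≈⟨ sym (undo φ w) ⟩
    _⋆_ A (_⋆_ A φ α) (inverse α) w            ≈⟨ ⋆-cong φα≋ψα (λ _ → refl) w ⟩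
    _⋆_ A (_⋆_ A ψ α) (inverse α) w            ≈⟨ undo ψ w ⟩
    ψ w                                        ∎
    where
    undo : ∀ χ → _≋_ A (_⋆_ A (_⋆_ A χ α) (inverse α)) χ
    undo χ u = begin
      _⋆_ A (_⋆_ A χ α) (inverse α) u ≈⟨ ⋆-assoc χ α (inverse α) u ⟩
      _⋆_ A χ (_⋆_ A α (inverse α)) u ≈⟨ ⋆-cong (λ _ → refl) (⋆-inverseʳ α α[]≈1) u ⟩
      _⋆_ A χ (e A) u                 ≈⟨ ⋆-identityʳ χ u ⟩
      χ u                             ∎

  conv₂-cancelˡ : ∀ {F H H′} → F [] [] ≈ 1# → (∀ x y → conv₂ F H x y ≈ conv₂ F H′ x y) →
                  ∀ x y → H x y ≈ H′ x y
  conv₂-cancelˡ {F} {H} {H′} F[][]≈1 FH≈FH′ x y =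
    All.wfRec (on-wellFounded size <-wellFounded) ℓ Agree step (x , y)
    where
    size : Word × Word → ℕ
    size (x , y) = length x +ℕ length y
    Agree : Word × Word → Set ℓ
    Agree (x , y) = H x y ≈ H′ x y
    Rest : (Word → Word → Carrier) → Word → Word → Carrier
    Rest G x y = splitSum⁺ (λ y₁ y₂ → F [] y₁ * G x y₂) y
               + splitSum⁺ (λ x₁ x₂ → splitSum (λ y₁ y₂ → F x₁ y₁ * G x₂ y₂) y) x
    leading : ∀ G x y → F [] [] * G x y ≈ G x y
    leading G x y = trans (*-congʳ F[][]≈1) (*-identityˡ _)
    step : ∀ p → (∀ {q} → size q < size p → Agree q) → Agree p
    step (x , y) ih = begin
      H x y              ≈⟨ sym (leading H x y) ⟩
      F [] [] * H x y    ≈⟨ +-cancelʳ (Rest H′ x y) _ _ sameSum ⟩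
      F [] [] * H′ x y   ≈⟨ leading H′ x y ⟩
      H′ x y             ∎
      where
      sameRest : Rest H x y ≈ Rest H′ x y
      sameRest =
        +-cong (splitSum⁺-cong-on y (λ k a b eq →
                  *-congˡ (ih {x , b} (+-monoʳ-< (length x) (properSuffix-< k a b eq)))))
               (splitSum⁺-cong-on x (λ k a b eq → splitSum-cong-on y (λ a′ b′ eq′ →
                  *-congˡ (ih {b , b′} (+-mono-<-≤ (properSuffix-< k a b eq) (suffix-≤ a′ b′ eq′))))))
      sameSum : F [] [] * H x y + Rest H′ x y ≈ F [] [] * H′ x y + Rest H′ x y
      sameSum = begin
        F [] [] * H x y + Rest H′ x y  ≈⟨ +-congˡ (sym sameRest) ⟩
        F [] [] * H x y + Rest H x y   ≈⟨ sym (conv₂-unfold F H x y) ⟩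
        conv₂ F H x y                  ≈⟨ FH≈FH′ x y ⟩
        conv₂ F H′ x y                 ≈⟨ conv₂-unfold F H′ x y ⟩
        F [] [] * H′ x y + Rest H′ x y ∎

  inverse-isCharacter : ∀ α → IsCharacter A α → IsCharacter A (inverse α)
  inverse-isCharacter α (α[]≈1 , α-mult) =
    refl , conv₂-cancelˡ (trans (lin-singleton α []) α[]≈1) sameConv
    where
    α⁻¹ = inverse α
    sameConv : ∀ x y → conv₂ (α ∘∗) (α⁻¹ ∘∗) x y ≈ conv₂ (α ∘∗) (λ a b → α⁻¹ a * α⁻¹ b) x y
    sameConv x y = begin
      conv₂ (α ∘∗) (α⁻¹ ∘∗) x y
        ≈⟨ sym (lin-conv-∗ x y α α⁻¹) ⟩
      lin A (conv α α⁻¹) (x ∗ y)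
        ≈⟨ lin-cong (conv-inverseʳ α α[]≈1) (x ∗ y) ⟩
      lin A (e A) (x ∗ y)
        ≈⟨ e-multiplicative x y ⟩
      e A x * e A y
        ≈⟨ sym (*-cong (conv-inverseʳ α α[]≈1 x) (conv-inverseʳ α α[]≈1 y)) ⟩
      conv α α⁻¹ x * conv α α⁻¹ y
        ≈⟨ sym (conv₂-⊗ α α α⁻¹ α⁻¹ x y) ⟩
      conv₂ (λ a b → α a * α b) (λ a b → α⁻¹ a * α⁻¹ b) x y
        ≈⟨ splitSum-cong (λ x₁ x₂ → splitSum-cong (λ y₁ y₂ → *-congʳ (sym (α-mult x₁ y₁))) y) x ⟩
      conv₂ (α ∘∗) (λ a b → α⁻¹ a * α⁻¹ b) x y ∎

  e-vanishes-on-N : ∀ w → NonSingular w → e A w ≈ 0#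
  e-vanishes-on-N (k ∷ w) _ = refl

  conv-congˡ-on-N : ∀ {φ ψ : LinMap A} h → φ [] ≈ ψ [] → (∀ w → NonSingular w → φ w ≈ ψ w) →
                    ∀ w → NonSingular w → conv φ h w ≈ conv ψ h w
  conv-congˡ-on-N {φ} {ψ} h φ[]≈ψ[] φ≈ψ w w∈N = conv-congˡ-on-prefixes h w agree
    where
    agree : ∀ a b → a ++ b ≡ w → φ a ≈ ψ a
    agree [] b _ = φ[]≈ψ[]
    agree (k ∷ a) b eq =
      φ≈ψ (k ∷ a) (nonSingular-prefix k a b (≡.subst NonSingular (≡.sym eq) w∈N))

  stabiliser-trivial : ∀ φ α → α [] ≈ 1# → _≋_ A (_⋆_ A φ α) α → _≋_ A φ (e A)
  stabiliser-trivial φ α α[]≈1 φα≋α =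
    ⋆-cancelʳ α α[]≈1 (λ w → trans (φα≋α w) (sym (⋆-identityˡ α w)))

  module _ (ζ : PartialMap A) where
    ⋆-preserves-X : ∀ φ α → InT A φ → InX A ζ α → InX A ζ (_⋆_ A φ α)
    ⋆-preserves-X φ α (φ-char@(φ[]≈1 , _) , φ-on-N) (α-char , α-on-N) =
      ⋆-isCharacter φ α φ-char α-char , λ w w∈N → begin
        _⋆_ A φ α w     ≈⟨ ⋆≈conv φ α w ⟩
        conv φ α w      ≈⟨ conv-congˡ-on-N α φ[]≈1 φ≈e-on-N w w∈N ⟩
        conv (e A) α w  ≈⟨ conv-identityˡ α w ⟩
        α w             ≈⟨ α-on-N w w∈N ⟩
        ζ w w∈N         ∎
      where
      φ≈e-on-N : ∀ w → NonSingular w → φ w ≈ e A w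
      φ≈e-on-N w w∈N = trans (φ-on-N w w∈N) (sym (e-vanishes-on-N w w∈N))

    T-transitive-on-X : ∀ α β → InX A ζ α → InX A ζ β → ∃ λ φ → InT A φ × _≋_ A (_⋆_ A φ α) β
    T-transitive-on-X α β ((α[]≈1 , α-mult) , α-on-N) ((β[]≈1 , β-mult) , β-on-N) =
      φ , (φ-char , φ-on-N) , φα≋β
      where
      α⁻¹ = inverse α
      φ = _⋆_ A β α⁻¹
      φ-char : IsCharacter A φ
      φ-char = ⋆-isCharacter β α⁻¹ (β[]≈1 , β-mult) (inverse-isCharacter α (α[]≈1 , α-mult))
      φ-on-N : ∀ w → NonSingular w → φ w ≈ 0#
      φ-on-N w w∈N = begin
        _⋆_ A β α⁻¹ w  ≈⟨ ⋆≈conv β α⁻¹ w ⟩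
        conv β α⁻¹ w   ≈⟨ conv-congˡ-on-N α⁻¹ (trans β[]≈1 (sym α[]≈1))
                            (λ u u∈N → trans (β-on-N u u∈N) (sym (α-on-N u u∈N))) w w∈N ⟩
        conv α α⁻¹ w   ≈⟨ conv-inverseʳ α α[]≈1 w ⟩
        e A w          ≈⟨ e-vanishes-on-N w w∈N ⟩
        0#             ∎
      φα≋β : _≋_ A (_⋆_ A φ α) β
      φα≋β w = begin
        _⋆_ A φ α w                ≈⟨ ⋆-assoc β α⁻¹ α w ⟩
        _⋆_ A β (_⋆_ A α⁻¹ α) w    ≈⟨ ⋆-cong (λ _ → refl) (⋆-inverseˡ α α[]≈1) w ⟩
        _⋆_ A β (e A) w            ≈⟨ ⋆-identityʳ β w ⟩
        β w                        ∎

mainTheorem3 : ∀ {c ℓ : Level} (A : QAlgebra c ℓ) (ζ : PartialMap A) →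
    -- well-defined: T_A × X_{A,ζ} → X_{A,ζ}
    (∀ φ α → InT A φ → InX A ζ α → InX A ζ (_⋆_ A φ α))
    -- identity axiom of a left action
  × (∀ α → InX A ζ α → _≋_ A (_⋆_ A (e A) α) α)
    -- compatibility axiom of a left action
  × (∀ φ ψ α → InT A φ → InT A ψ → InX A ζ α →
       _≋_ A (_⋆_ A (_⋆_ A φ ψ) α) (_⋆_ A φ (_⋆_ A ψ α)))
    -- free
  × (∀ φ α → InT A φ → InX A ζ α → _≋_ A (_⋆_ A φ α) α → _≋_ A φ (e A))
    -- transitive
  × (∀ α β → InX A ζ α → InX A ζ β →
       ∃ λ φ → InT A φ × _≋_ A (_⋆_ A φ α) β)
mainTheorem3 A ζ =
    ⋆-preserves-X A ζ
  , (λ α _ → ⋆-identityˡ A α)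
  , (λ φ ψ α _ _ _ → ⋆-assoc A φ ψ α)
  , (λ φ α _ ((α[]≈1 , _) , _) → stabiliser-trivial A φ α α[]≈1)
  , T-transitive-on-X A ζ
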